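{- Let $\mathcal{M}=(X,\vec{\mathcal{C}},\mathcal{V})$ be a quasi-discrete closure model. Then the relation $\simeq$ on $X$ defined by $x_1\simeq x_2$ iff $x_1$ and $x_2$ satisfy exactly the same ${\tt IML}$ formulas in $\mathcal{M}$ is a CM-bisimulation for $\mathcal{M}$.
   Context: Fix a set $\mathtt{AP}$ of atomic propositions. For a relation $R\subseteq X\times X$ let $\mathcal{C}_R(A)=A\cup\{x\in X:\exists a\in A,\ (a,x)\in R\}$. A quasi-discrete closure model is $\mathcal{M}=(X,\vec{\mathcal{C}},\mathcal{V})$ with $\vec{\mathcal{C}}=\mathcal{C}_R$ for some relation $R\subseteq X\times X$ and $\mathcal{V}:\mathtt{AP}\to\mathcal{P}(X)$. The interior is $\mathcal{I}(A)=X\setminus\vec{\mathcal{C}}(X\setminus A)$. A symmetric relation $B\subseteq X\times X$ is a CM-bisimulation if whenever $(x_1,x_2)\in B$: (1) for all $p\in\mathtt{AP}$, $x_1\in\mathcal{V}(p)$ iff $x_2\in\mathcal{V}(p)$; (2) for every $S_1\subseteq X$ with $x_1\in\mathcal{I}(S_1)$ there is $S_2\subseteq X$ with $x_2\in\mathcal{I}(S_2)$ such that each $s_2\in S_2$ has some $s_1\in S_1$ with $(s_1,s_2)\in B$. ${\tt IML}$ formulas: $\Phi::=p\mid\neg\Phi\mid\bigwedge_{i\in I}\Phi_i\mid\mathcal{N}\Phi$ ($I$ arbitrary index set); $x\models p$ iff $x\in\mathcal{V}(p)$, usual Boolean clauses, and $x\models\mathcal{N}\Phi$ iff $x\in\vec{\mathcal{C}}(\{y:y\models\Phi\})$.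 -}

module Defs where

open import Level using (Level; _⊔_) renaming (suc to lsuc; zero to lzero)
open import Data.Product using (Σ; ∃; _×_; _,_)
open import Data.Sum using (_⊎_)
open import Relation.Nullary using (¬_)
open import Function.Bundles using (_⇔_)

Subset : Set → Set₁
Subset X = X → Set

C[_] : {X : Set} → (X → X → Set) → Subset X → Subset X
C[ R ] A x = A x ⊎ Σ _ (λ a → A a × R a x)

∁ : {X : Set} → Subset X → Subset X
∁ A x = ¬ A x

record QDCM (AP : Set) : Set₁ where
  field
    X : Set
    R : X → X → Set
    V : AP → Subset X

  C⃗ : Subset X → Subset X
  C⃗ = C[ R ]

  I : Subset X → Subset X
  I A = ∁ (C⃗ (∁ A))

data IML (AP : Set) : Set₁ where
  atom : AP → IML AP
  ¬′   : IML AP → IML AP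
  ⋀    : (I : Set) → (I → IML AP) → IML AP
  𝒩    : IML AP → IML AP

module _ {AP : Set} (M : QDCM AP) where
  open QDCM M

  _⊨_ : X → IML AP → Set
  x ⊨ atom p  = V p x
  x ⊨ ¬′ Φ    = ¬ (x ⊨ Φ)
  x ⊨ ⋀ I Φs  = (i : I) → x ⊨ Φs i
  x ⊨ 𝒩 Φ     = C⃗ (λ y → y ⊨ Φ) x

  _≃_ : X → X → Set₁
  x₁ ≃ x₂ = (Φ : IML AP) → (x₁ ⊨ Φ) ⇔ (x₂ ⊨ Φ)

  record IsCMBisimulation {ℓ : Level} (B : X → X → Set ℓ) : Set (lsuc lzero ⊔ ℓ) where
    field
      symmetric : ∀ {x₁ x₂} → B x₁ x₂ → B x₂ x₁
      atoms     : ∀ {x₁ x₂} → B x₁ x₂ → (p : AP) → V p x₁ ⇔ V p x₂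
      interior  : ∀ {x₁ x₂} → B x₁ x₂ → (S₁ : Subset X) → I S₁ x₁ →
                  Σ (Subset X) (λ S₂ → I S₂ x₂ ×
                    ((s₂ : X) → S₂ s₂ → Σ X (λ s₁ → S₁ s₁ × B s₁ s₂)))

-- Take S₂ to be the ≃-image of S₁. If x₂ (which lies in S₂) were not in its interior, some R-successor a of x₂
-- lies outside S₂, i.e. a is inequivalent to every point of S₁. Conjoining, over all of S₁,
-- formulas that separate a from each point gives Ψ with a ⊨ Ψ and Ψ false on S₁. Then
-- x₂ ⊨ 𝒩 Ψ, hence x₁ ⊨ 𝒩 Ψ, which puts x₁ in the closure of the complement of S₁.
module Submission where

open import Defs
open import Level using (lift; lower) renaming (suc to lsuc; zero to lzero)
open import Axiom.ExcludedMiddle using (ExcludedMiddle)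
open import Axiom.DoubleNegationElimination using (em⇒dne)
open import Data.Product using (Σ; _×_; _,_; proj₁; proj₂)
open import Data.Sum using (inj₁; inj₂)
open import Relation.Nullary using (¬_; Stable)
open import Relation.Nullary.Decidable using (True; toWitness; fromWitness; map′; decidable-stable)
open import Function.Bundles using (mk⇔; Equivalence)

module _ (em : ExcludedMiddle (lsuc lzero)) {AP : Set} (M : QDCM AP) where
  open QDCM M
  open Equivalence

  private
    _⊨′_ : X → IML AP → Set
    _⊨′_ = _⊨_ M

    _≃′_ : X → X → Set₁
    _≃′_ = _≃_ M

  stable : {P : Set} → Stable P
  stable = decidable-stable (map′ lower lift em)

  interior⊆ : {A : Subset X} {x : X} → I A x → A x
  interior⊆ x∈IA = stable (λ x∉A → x∈IA (inj₁ x∉A))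

  ≃-sym : ∀ {x₁ x₂} → x₁ ≃′ x₂ → x₂ ≃′ x₁
  ≃-sym x₁≃x₂ Φ = mk⇔ (from (x₁≃x₂ Φ)) (to (x₁≃x₂ Φ))

  Distinguishes : IML AP → X → X → Set
  Distinguishes Φ s a = (a ⊨′ Φ) × ¬ (s ⊨′ Φ)

  no-distinguishing⇒≃ : ∀ {s a} → ¬ Σ (IML AP) (λ Φ → Distinguishes Φ s a) → s ≃′ a
  no-distinguishing⇒≃ none Φ = mk⇔
    (λ s⊨Φ → stable (λ a⊭Φ → none (¬′ Φ , a⊭Φ , λ s⊭Φ → s⊭Φ s⊨Φ)))
    (λ a⊨Φ → stable (λ s⊭Φ → none (Φ , a⊨Φ , s⊭Φ)))

  ≄⇒distinguishing : ∀ {s a} → ¬ s ≃′ a → Σ (IML AP) (λ Φ → Distinguishes Φ s a)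
  ≄⇒distinguishing s≄a = em⇒dne em (λ none → s≄a (no-distinguishing⇒≃ none))

  -- The conjunction is indexed by S itself, which is why IML needs arbitrary index sets.
  separating-formula : (S : Subset X) (a : X) → (∀ s → S s → ¬ s ≃′ a) →
                       Σ (IML AP) (λ Ψ → (a ⊨′ Ψ) × (∀ s → S s → ¬ s ⊨′ Ψ))
  separating-formula S a S≄a =
    ⋀ (Σ X S) (λ s → proj₁ (separator s)) ,
    (λ s → proj₁ (proj₂ (separator s))) ,
    (λ s s∈S s⊨Ψ → proj₂ (proj₂ (separator (s , s∈S))) (s⊨Ψ (s , s∈S)))
    where
    separator : (s : Σ X S) → Σ (IML AP) (λ Φ → Distinguishes Φ (proj₁ s) a)
    separator (s , s∈S) = ≄⇒distinguishing (S≄a s s∈S)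

  -- Subsets are Set-valued while ≃ lives in Set₁, so membership is squashed through em.
  ≃-image : Subset X → Subset X
  ≃-image S y = True (em {Σ X (λ s → S s × s ≃′ y)})

  ≃-image-interior : ∀ {x₁ x₂} → x₁ ≃′ x₂ → (S : Subset X) → I S x₁ → I (≃-image S) x₂
  ≃-image-interior {x₁} x₁≃x₂ S x₁∈IS (inj₁ x₂∉image) =
    x₂∉image (fromWitness (x₁ , interior⊆ x₁∈IS , x₁≃x₂))
  ≃-image-interior {x₁} x₁≃x₂ S x₁∈IS (inj₂ (a , a∉image , x₂Ra))
    with separating-formula S a (λ s s∈S s≃a → a∉image (fromWitness (s , s∈S , s≃a)))
  ... | Ψ , a⊨Ψ , S⊭Ψ with from (x₁≃x₂ (𝒩 Ψ)) (inj₂ (a , a⊨Ψ , x₂Ra))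
  ...   | inj₁ x₁⊨Ψ = S⊭Ψ x₁ (interior⊆ x₁∈IS) x₁⊨Ψ
  ...   | inj₂ (b , b⊨Ψ , x₁Rb) = x₁∈IS (inj₂ (b , (λ b∈S → S⊭Ψ b b∈S b⊨Ψ) , x₁Rb))

lemma3p7 : ExcludedMiddle (lsuc lzero) → {AP : Set} → (M : QDCM AP) →
    IsCMBisimulation M (_≃_ M)
lemma3p7 em M = record
  { symmetric = ≃-sym em M
  ; atoms     = λ x₁≃x₂ p → x₁≃x₂ (atom p)
  ; interior  = λ x₁≃x₂ S₁ x₁∈IS₁ →
      ≃-image em M S₁ , ≃-image-interior em M x₁≃x₂ S₁ x₁∈IS₁ , λ _ → toWitness
  }
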